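{- There exists a constant $\alpha>0$ such that for all sufficiently large $X$, \[ \#\{1\leq n\leq X:\ \sigma moex(n)\text{ is even}\}\geq \alpha\log\log X . \]
   Context: For a partition $\pi$ of a positive integer $n$, $moex(\pi)$ is the smallest odd positive integer that is not a part of $\pi$. For a positive integer $n$, $\sigma moex(n)=\sum_{\pi} moex(\pi)$, summed over all partitions $\pi$ of $n$, and $\sigma moex(0)=1$. Equivalently, $\sum_{n\geq 0}\sigma moex(n)q^n=(-q;q)_\infty(-q;q^2)_\infty^2$, where $(a;q)_\infty=\prod_{m\geq 1}(1-aq^{m-1})$. -}

module Defs where

open import Data.Nat using (ℕ; zero; suc; _+_; _*_; _∸_; _^_; _≡ᵇ_; _/_; _%_)
open import Data.Bool using (Bool; true; false; if_then_else_)
open import Data.List using (List; []; _∷_; _++_; map; concatMap; upTo; replicate; length; filterᵇ)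
open import Data.Bool.ListAction using (any)

-- Partitions of n with all parts ≤ k, as weakly decreasing lists of positive
-- parts: choose the multiplicity m of the part k (0 ≤ m ≤ n / k), then
-- partition the rest into parts ≤ k - 1.
partsLE : ℕ → ℕ → List (List ℕ)
partsLE zero zero = [] ∷ []
partsLE zero (suc n) = []
partsLE (suc k) n =
  concatMap (λ m → map (replicate m (suc k) ++_) (partsLE k (n ∸ m * suc k)))
            (upTo (suc (n / suc k)))

partitions : ℕ → List (List ℕ)
partitions n = partsLE n n

-- moex π: the smallest odd positive integer that is not a part of π.
-- Search over 1, 3, 5, ...; fuel length π + 1 suffices since π has at most
-- length π distinct odd parts.
moexGo : ℕ → ℕ → List ℕ → ℕ
moexGo zero j π = suc (2 * j)
moexGo (suc f) j π =
  if any (λ x → x ≡ᵇ suc (2 * j)) π then moexGo f (suc j) π else suc (2 * j)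

moex : List ℕ → ℕ
moex π = moexGo (suc (length π)) 0 π

sumℕ : List ℕ → ℕ
sumℕ [] = 0
sumℕ (x ∷ xs) = x + sumℕ xs

σmoex : ℕ → ℕ
σmoex n = sumℕ (map moex (partitions n))

evenCount : ℕ → ℕ
evenCount X = length (filterᵇ (λ n → σmoex n % 2 ≡ᵇ 0) (map suc (upTo X)))

-- Since moex π is always odd, σmoex(n) ≡ p(n) (mod 2) for the partition function p.
-- Reducing Euler's pentagonal recurrence Σⱼ (-1)ʲ p(n - ω(j)) = 0 (n ≥ 1, ω(j) = j(3j+1)/2)
-- modulo 2, the sum Σⱼ p(n - ω(j)) is even; this is proved by the Bressoud–Zeilberger
-- involution on pairs (j, π) with |π| + ω(j) = n. Adding the statements for n = ω(k+1)
-- and n = ω(k+1) - 1, every index j ≠ k+1 contributes p(a+1) + p(a) or nothing, while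
-- j = k+1 contributes p(0) = 1; so p cannot be odd on all of [k, ω(k+1)]. For
-- k₀ = 1, kₜ₊₁ = ω(kₜ) + 2 the windows [kₜ - 1, ω(kₜ)] are disjoint and 4kₜ ≤ 2^(2^(t+1)),
-- whence evenCount X ≥ (log₂ log₂ X) / 3 for X ≥ 2.

module Submission where

open import Defs
open import Data.Bool using (Bool; true; false)
open import Data.Bool.ListAction using (any)
open import Data.Empty using (⊥-elim)
open import Data.List using (List; []; _∷_; _++_; [_]; map; drop; concatMap; replicate; length; upTo; filter; filterᵇ)
open import Data.List.Properties
  using (length-++; length-map; length-replicate; map-++; upTo-∷ʳ; filter-++; filter-all; ++-cancelˡ)
  renaming (≡-dec to List-≡-dec)
open import Data.List.Membership.Propositional using (_∈_; find; lose)
open import Data.List.Membership.Propositional.Properties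
  using (∈-concatMap⁺; ∈-concatMap⁻; ∈-filter⁺; ∈-filter⁻; ∈-map⁺; ∈-map⁻; ∈-upTo⁺; ∈-upTo⁻)
open import Data.List.Relation.Unary.All as All using ()
open import Data.List.Relation.Unary.Any using (here; there)
open import Data.List.Relation.Unary.Unique.Propositional using (Unique; []; _∷_)
open import Data.List.Relation.Unary.Unique.Propositional.Properties as Unique using (upTo⁺)
open import Data.Nat
open import Data.Nat.DivMod using ([m+n]%n≡m%n; m/n*n≤m; m*n/n≡m; /-monoˡ-≤)
open import Data.Nat.Properties
open import Data.Nat.Tactic.RingSolver using (solve-∀)
open import Data.Parity.Base as ℙ using (0ℙ; 1ℙ)
open import Data.Parity.Properties using (+-homo-+; p≢p⁻¹) renaming (_≟_ to _≟ᵖ_)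
open import Data.Product using (∃-syntax; _×_; _,_; proj₁; proj₂)
open import Data.Product.Properties using () renaming (≡-dec to ×-≡-dec)
open import Data.Sum using (_⊎_; inj₁; inj₂)
open import Function using (_∘_)
open import Relation.Binary.PropositionalEquality hiding ([_])
open import Relation.Nullary using (¬_; ¬?; Dec; yes; no)
open import Relation.Binary.Definitions using (DecidableEquality; tri<; tri≈; tri>)
open import Relation.Nullary.Decidable using (_×-dec_; decidable-stable)

-- Linear identities are derived by exhibiting X + B ≡ Y + A as a ring identity.
cancel-≡ : ∀ {X Y A B} → A ≡ B → X + B ≡ Y + A → X ≡ Y
cancel-≡ {X} {Y} {A} A≡B X+B≡Y+A = +-cancelʳ-≡ A X Y (trans (cong (X +_) A≡B) X+B≡Y+A)

m≡n+o⇒m∸o≡n : ∀ {m} n o → m ≡ n + o → m ∸ o ≡ n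
m≡n+o⇒m∸o≡n n o refl = m+n∸n≡m n o

monotone-by-step : (f : ℕ → ℕ) → (∀ n → f n ≤ f (suc n)) → ∀ {m n} → m ≤ n → f m ≤ f n
monotone-by-step f step {m} m≤n with m≤n⇒∃[o]m+o≡n m≤n
... | d , refl = go d
  where
  go : ∀ d → f m ≤ f (m + d)
  go zero rewrite +-identityʳ m = ≤-refl
  go (suc d) rewrite +-suc m d = ≤-trans (go d) (step (m + d))

parity≢0ℙ⇒1ℙ : ∀ {q} → q ≢ 0ℙ → q ≡ 1ℙ
parity≢0ℙ⇒1ℙ {0ℙ} q≢0ℙ = ⊥-elim (q≢0ℙ refl)
parity≢0ℙ⇒1ℙ {1ℙ} _ = refl

parity-odd : ∀ j → parity (suc (2 * j)) ≡ 1ℙ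
parity-odd zero = refl
parity-odd (suc j) rewrite +-suc j (j + 0) = parity-odd j

parity-sumℕ-odd : ∀ {A : Set} (f : A → ℕ) → (∀ x → parity (f x) ≡ 1ℙ) →
                  ∀ xs → parity (sumℕ (map f xs)) ≡ parity (length xs)
parity-sumℕ-odd f odd [] = refl
parity-sumℕ-odd f odd (x ∷ xs) = begin
  parity (f x + sumℕ (map f xs))             ≡⟨ +-homo-+ (f x) _ ⟩
  parity (f x) ℙ.+ parity (sumℕ (map f xs))  ≡⟨ cong₂ ℙ._+_ (odd x) (parity-sumℕ-odd f odd xs) ⟩
  1ℙ ℙ.+ parity (length xs)                  ≡⟨ +-homo-+ 1 (length xs) ⟨
  parity (suc (length xs))                   ∎
  where open ≡-Reasoning

parity-sumℕ-even : ∀ {A : Set} (f : A → ℕ) xs → (∀ {x} → x ∈ xs → parity (f x) ≡ 0ℙ) →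
                   parity (sumℕ (map f xs)) ≡ 0ℙ
parity-sumℕ-even f [] _ = refl
parity-sumℕ-even f (x ∷ xs) even
  rewrite +-homo-+ (f x) (sumℕ (map f xs)) | even (here refl) = parity-sumℕ-even f xs (even ∘ there)

parity-sumℕ-single-odd : ∀ {A : Set} (f : A → ℕ) {x xs} → Unique xs → x ∈ xs → parity (f x) ≡ 1ℙ →
                         (∀ {y} → y ∈ xs → y ≢ x → parity (f y) ≡ 0ℙ) → parity (sumℕ (map f xs)) ≡ 1ℙ
parity-sumℕ-single-odd f {xs = y ∷ ys} (y∉ys ∷ _) (here refl) odd even
  rewrite +-homo-+ (f y) (sumℕ (map f ys)) | odd
        | parity-sumℕ-even f ys (λ y′∈ → even (there y′∈) (All.lookup y∉ys y′∈ ∘ sym)) = refl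
parity-sumℕ-single-odd f {xs = y ∷ ys} (y∉ys ∷ u) (there x∈ys) odd even
  rewrite +-homo-+ (f y) (sumℕ (map f ys)) | even (here refl) (All.lookup y∉ys x∈ys)
        | parity-sumℕ-single-odd f u x∈ys odd (even ∘ there) = refl

length-concatMap : ∀ {A B : Set} (f : A → List B) xs → length (concatMap f xs) ≡ sumℕ (map (length ∘ f) xs)
length-concatMap f [] = refl
length-concatMap f (x ∷ xs) = trans (length-++ (f x)) (cong (length (f x) +_) (length-concatMap f xs))

sumℕ-map-+ : ∀ {A : Set} (f g : A → ℕ) xs →
             sumℕ (map (λ x → f x + g x) xs) ≡ sumℕ (map f xs) + sumℕ (map g xs)
sumℕ-map-+ f g [] = refl
sumℕ-map-+ f g (x ∷ xs) rewrite sumℕ-map-+ f g xs = identity (f x) (g x) (sumℕ (map f xs)) (sumℕ (map g xs))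
  where
  identity : ∀ a b c d → a + b + (c + d) ≡ a + c + (b + d)
  identity = solve-∀

module _ {A B : Set} (f : A → List B) where

  ∈-concatMap⁺′ : ∀ {x y xs} → x ∈ xs → y ∈ f x → y ∈ concatMap f xs
  ∈-concatMap⁺′ x∈xs y∈fx = ∈-concatMap⁺ f (lose x∈xs y∈fx)

  ∈-concatMap⁻′ : ∀ {y} xs → y ∈ concatMap f xs → ∃[ x ] x ∈ xs × y ∈ f x
  ∈-concatMap⁻′ xs y∈ = find (∈-concatMap⁻ f y∈)

  concatMap-unique : (key : B → A) → (∀ {x y} → y ∈ f x → key y ≡ x) →
                     (∀ x → Unique (f x)) → ∀ {xs} → Unique xs → Unique (concatMap f xs)
  concatMap-unique key key-f uf [] = []
  concatMap-unique key key-f uf {x ∷ xs} (x∉xs ∷ u) =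
    Unique.++⁺ (uf x) (concatMap-unique key key-f uf u) disjoint
    where
    disjoint : ∀ {y} → ¬ (y ∈ f x × y ∈ concatMap f xs)
    disjoint (y∈fx , y∈rest) with ∈-concatMap⁻′ xs y∈rest
    ... | x′ , x′∈xs , y∈fx′ = All.lookup x∉xs x′∈xs (trans (sym (key-f y∈fx)) (key-f y∈fx′))

record FixedPointFreeInvolutionOn {A : Set} (φ : A → A) (xs : List A) : Set where
  field
    closed : ∀ {x} → x ∈ xs → φ x ∈ xs
    involutive : ∀ {x} → x ∈ xs → φ (φ x) ≡ x
    fixedPointFree : ∀ {x} → x ∈ xs → φ x ≢ x

module _ {A : Set} (_≟ᴬ_ : DecidableEquality A) where

  without : A → List A → List A
  without y = filter (λ z → ¬? (z ≟ᴬ y))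

  length-without : ∀ {y xs} → Unique xs → y ∈ xs → suc (length (without y xs)) ≡ length xs
  length-without {y} {z ∷ zs} (z∉zs ∷ u) y∈ with z ≟ᴬ y
  ... | yes refl = cong suc (cong length (filter-all (λ z′ → ¬? (z′ ≟ᴬ y)) (All.map (_∘ sym) z∉zs)))
  length-without {y} {z ∷ zs} (z∉zs ∷ u) (here refl) | no z≢y = ⊥-elim (z≢y refl)
  length-without {y} {z ∷ zs} (z∉zs ∷ u) (there y∈) | no z≢y = cong suc (length-without u y∈)

  module _ {φ : A → A} {x xs} (inv : FixedPointFreeInvolutionOn φ (x ∷ xs)) where
    open FixedPointFreeInvolutionOn inv

    partner∈ : φ x ∈ xs
    partner∈ with closed (here refl)
    ... | here φx≡x = ⊥-elim (fixedPointFree (here refl) φx≡x)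
    ... | there φx∈xs = φx∈xs

    without-partner : Unique (x ∷ xs) → FixedPointFreeInvolutionOn φ (without (φ x) xs)
    without-partner (x∉xs ∷ _) = record
      { closed = closed′
      ; involutive = involutive ∘ ⊆x∷xs
      ; fixedPointFree = fixedPointFree ∘ ⊆x∷xs
      }
      where
      ⊆x∷xs : ∀ {z} → z ∈ without (φ x) xs → z ∈ x ∷ xs
      ⊆x∷xs z∈ = there (proj₁ (∈-filter⁻ _ z∈))
      closed′ : ∀ {z} → z ∈ without (φ x) xs → φ z ∈ without (φ x) xs
      closed′ {z} z∈ with ∈-filter⁻ _ z∈
      ... | z∈xs , z≢φx with closed (there z∈xs)
      ...   | here φz≡x = ⊥-elim (z≢φx (trans (sym (involutive (there z∈xs))) (cong φ φz≡x)))
      ...   | there φz∈xs = ∈-filter⁺ _ φz∈xs φz≢φx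
        where
        φz≢φx : φ z ≢ φ x
        φz≢φx φz≡φx = All.lookup x∉xs z∈xs
          (sym (trans (sym (involutive (there z∈xs))) (trans (cong φ φz≡φx) (involutive (here refl)))))

  FixedPointFreeInvolution⇒even-length : ∀ {φ xs} → Unique xs → FixedPointFreeInvolutionOn φ xs →
                                          parity (length xs) ≡ 0ℙ
  FixedPointFreeInvolution⇒even-length = by-size _ _ refl
    where
    by-size : ∀ {φ} n xs → length xs ≡ n → Unique xs →
              FixedPointFreeInvolutionOn φ xs → parity (length xs) ≡ 0ℙ
    by-size zero [] _ _ _ = refl
    by-size (suc zero) (x ∷ []) _ _ inv with partner∈ inv
    ... | ()
    by-size (suc (suc n)) (x ∷ xs) len u@(_ ∷ u′) inv =
      trans (cong (parity ∘ suc) (sym (length-without u′ (partner∈ inv))))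
            (by-size n _ (suc-injective (trans (length-without u′ (partner∈ inv)) (suc-injective len)))
                     (Unique.filter⁺ _ u′) (without-partner inv u))

data Partition≤ : ℕ → List ℕ → Set where
  [] : ∀ {b} → Partition≤ b []
  cons : ∀ {b x xs} → 1 ≤ x → x ≤ b → Partition≤ x xs → Partition≤ b (x ∷ xs)

Partition≤-weaken : ∀ {a b xs} → a ≤ b → Partition≤ a xs → Partition≤ b xs
Partition≤-weaken a≤b [] = []
Partition≤-weaken a≤b (cons 1≤x x≤a π) = cons 1≤x (≤-trans x≤a a≤b) π

Partition≤-replicate : ∀ {k ρ} m → Partition≤ k ρ → Partition≤ (suc k) (replicate m (suc k) ++ ρ)
Partition≤-replicate zero ρ = Partition≤-weaken (n≤1+n _) ρ
Partition≤-replicate (suc m) ρ = cons (s≤s z≤n) ≤-refl (Partition≤-replicate m ρ)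

Partition≤-split : ∀ {k π} → Partition≤ (suc k) π →
                   ∃[ m ] ∃[ ρ ] π ≡ replicate m (suc k) ++ ρ × Partition≤ k ρ
Partition≤-split [] = 0 , [] , refl , []
Partition≤-split {k} (cons {x = x} 1≤x x≤k+1 π) with x ≟ suc k
... | yes refl with Partition≤-split π
...   | m , ρ , refl , ρ≤k = suc m , ρ , refl , ρ≤k
Partition≤-split {k} (cons {x = x} 1≤x x≤k+1 π) | no x≢k+1 =
  0 , _ , refl , cons 1≤x (≤-pred (≤∧≢⇒< x≤k+1 x≢k+1)) π

sumℕ-replicate-++ : ∀ m c ρ → sumℕ (replicate m c ++ ρ) ≡ m * c + sumℕ ρ
sumℕ-replicate-++ zero c ρ = refl
sumℕ-replicate-++ (suc m) c ρ rewrite sumℕ-replicate-++ m c ρ = sym (+-assoc c (m * c) (sumℕ ρ))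

leadingCount : ℕ → List ℕ → ℕ
leadingCount c [] = 0
leadingCount c (x ∷ xs) with x ≟ c
... | yes _ = suc (leadingCount c xs)
... | no _ = 0

leadingCount-replicate : ∀ {k} m {ρ} → Partition≤ k ρ → leadingCount (suc k) (replicate m (suc k) ++ ρ) ≡ m
leadingCount-replicate {k} (suc m) ρ with suc k ≟ suc k
... | yes _ = cong suc (leadingCount-replicate m ρ)
... | no k+1≢k+1 = ⊥-elim (k+1≢k+1 refl)
leadingCount-replicate zero [] = refl
leadingCount-replicate {k} zero (cons {x = x} _ x≤k _) with x ≟ suc k
... | yes refl = ⊥-elim (<-irrefl refl x≤k)
... | no _ = refl

partsLE-block : ℕ → ℕ → ℕ → List (List ℕ)
partsLE-block k n m = map (replicate m (suc k) ++_) (partsLE k (n ∸ m * suc k))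

∈-partsLE⁻ : ∀ k n {π} → π ∈ partsLE k n → Partition≤ k π × sumℕ π ≡ n
∈-partsLE⁻ zero zero (here refl) = [] , refl
∈-partsLE⁻ (suc k) n π∈ with ∈-concatMap⁻′ (partsLE-block k n) (upTo (suc (n / suc k))) π∈
... | m , m∈ , π∈′ with ∈-map⁻ _ π∈′
... | ρ , ρ∈ , refl with ∈-partsLE⁻ k (n ∸ m * suc k) ρ∈
... | ρ≤k , sumρ = Partition≤-replicate m ρ≤k , (begin
  sumℕ (replicate m (suc k) ++ ρ) ≡⟨ sumℕ-replicate-++ m (suc k) ρ ⟩
  m * suc k + sumℕ ρ              ≡⟨ cong (m * suc k +_) sumρ ⟩
  m * suc k + (n ∸ m * suc k)     ≡⟨ m+[n∸m]≡n mk≤n ⟩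
  n                               ∎)
  where
  open ≡-Reasoning
  mk≤n : m * suc k ≤ n
  mk≤n = ≤-trans (*-monoˡ-≤ (suc k) (≤-pred (∈-upTo⁻ m∈))) (m/n*n≤m n (suc k))

∈-partsLE⁺ : ∀ k n {π} → Partition≤ k π → sumℕ π ≡ n → π ∈ partsLE k n
∈-partsLE⁺ zero zero [] refl = here refl
∈-partsLE⁺ zero _ (cons 1≤x x≤0 _) _ = ⊥-elim (<⇒≱ 1≤x x≤0)
∈-partsLE⁺ (suc k) n π≤ sumπ with Partition≤-split π≤
... | m , ρ , refl , ρ≤k =
  ∈-concatMap⁺′ (partsLE-block k n) (∈-upTo⁺ (s≤s m≤n/k)) (∈-map⁺ _ (∈-partsLE⁺ k _ ρ≤k sumρ))
  where
  sum-split : m * suc k + sumℕ ρ ≡ n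
  sum-split = trans (sym (sumℕ-replicate-++ m (suc k) ρ)) sumπ
  sumρ : sumℕ ρ ≡ n ∸ m * suc k
  sumρ = sym (trans (cong (_∸ m * suc k) (sym sum-split)) (m+n∸m≡n (m * suc k) (sumℕ ρ)))
  m≤n/k : m ≤ n / suc k
  m≤n/k = subst (_≤ n / suc k) (m*n/n≡m m (suc k))
                (/-monoˡ-≤ (suc k) (subst (m * suc k ≤_) sum-split (m≤m+n _ _)))

partsLE-unique : ∀ k n → Unique (partsLE k n)
partsLE-unique zero zero = All.[] ∷ []
partsLE-unique zero (suc n) = []
partsLE-unique (suc k) n =
  concatMap-unique (partsLE-block k n) (leadingCount (suc k)) leading
    (λ m → Unique.map⁺ (++-cancelˡ (replicate m (suc k)) _ _) (partsLE-unique k _)) (upTo⁺ (suc (n / suc k)))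
  where
  leading : ∀ {m π} → π ∈ partsLE-block k n m → leadingCount (suc k) π ≡ m
  leading {m} π∈ with ∈-map⁻ _ π∈
  ... | ρ , ρ∈ , refl = leadingCount-replicate m (proj₁ (∈-partsLE⁻ k _ ρ∈))

∈-partitions⁻ : ∀ {n π} → π ∈ partitions n → Partition≤ n π × sumℕ π ≡ n
∈-partitions⁻ {n} = ∈-partsLE⁻ n n

∈-partitions⁺ : ∀ {n π} → Partition≤ n π → sumℕ π ≡ n → π ∈ partitions n
∈-partitions⁺ {n} = ∈-partsLE⁺ n n

p : ℕ → ℕ
p n = length (partitions n)

parity-moexGo : ∀ f j π → parity (moexGo f j π) ≡ 1ℙ
parity-moexGo zero j π = parity-odd j
parity-moexGo (suc f) j π with any (λ x → x ≡ᵇ suc (2 * j)) π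
... | true = parity-moexGo f (suc j) π
... | false = parity-odd j

parity-σmoex : ∀ n → parity (σmoex n) ≡ parity (p n)
parity-σmoex n = parity-sumℕ-odd moex (λ π → parity-moexGo (suc (length π)) 0 π) (partitions n)

even⇒%2≡0 : ∀ n → parity n ≡ 0ℙ → n % 2 ≡ 0
even⇒%2≡0 zero _ = refl
even⇒%2≡0 (suc (suc n)) even =
  trans (cong (_% 2) (+-comm 2 n)) (trans ([m+n]%n≡m%n n 2) (even⇒%2≡0 n even))

hasEvenσmoex : ℕ → Bool
hasEvenσmoex n = σmoex n % 2 ≡ᵇ 0

p-even⇒hasEvenσmoex : ∀ n → parity (p n) ≡ 0ℙ → hasEvenσmoex n ≡ true
p-even⇒hasEvenσmoex n even rewrite even⇒%2≡0 (σmoex n) (trans (parity-σmoex n) even) = refl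

evenCount-suc : ∀ X → evenCount (suc X) ≡ evenCount X + length (filterᵇ hasEvenσmoex [ suc X ])
evenCount-suc X = begin
  length (E (map suc (upTo (suc X))))           ≡⟨ cong (length ∘ E ∘ map suc) (upTo-∷ʳ X) ⟨
  length (E (map suc (upTo X ++ [ X ])))        ≡⟨ cong (length ∘ E) (map-++ suc (upTo X) [ X ]) ⟩
  length (E (map suc (upTo X) ++ [ suc X ]))    ≡⟨ cong length (filter-++ _ (map suc (upTo X)) [ suc X ]) ⟩
  length (E (map suc (upTo X)) ++ E [ suc X ]) ≡⟨ length-++ (E (map suc (upTo X))) ⟩
  evenCount X + length (E [ suc X ])            ∎
  where
  open ≡-Reasoning
  E = filterᵇ hasEvenσmoex

evenCount-mono : ∀ {X Y} → X ≤ Y → evenCount X ≤ evenCount Y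
evenCount-mono = monotone-by-step evenCount λ X → subst (evenCount X ≤_) (sym (evenCount-suc X)) (m≤m+n _ _)

evenCount-suc-even : ∀ j → parity (p (suc j)) ≡ 0ℙ → evenCount (suc j) ≡ suc (evenCount j)
evenCount-suc-even j even rewrite evenCount-suc j | p-even⇒hasEvenσmoex (suc j) even = +-comm (evenCount j) 1

-- The generalised pentagonal numbers: ω⁺ k = ω(k) = k(3k+1)/2, ω⁻ k = ω(-k) = k(3k-1)/2,
-- and ωᶻ N J = ω(J - N), the integer index j being encoded as J = N + j.
ω⁺ : ℕ → ℕ
ω⁺ zero = 0
ω⁺ (suc k) = ω⁺ k + (3 * k + 2)

ω⁻ : ℕ → ℕ
ω⁻ zero = 0
ω⁻ (suc k) = ω⁻ k + (3 * k + 1)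

ωᶻ : ℕ → ℕ → ℕ
ωᶻ zero J = ω⁺ J
ωᶻ (suc N) zero = ω⁻ (suc N)
ωᶻ (suc N) (suc J) = ωᶻ N J

ωᶻ-above : ∀ N i → ωᶻ N (N + i) ≡ ω⁺ i
ωᶻ-above zero i = refl
ωᶻ-above (suc N) i = ωᶻ-above N i

ωᶻ-below : ∀ J i → ωᶻ (J + i) J ≡ ω⁻ i
ωᶻ-below zero zero = refl
ωᶻ-below zero (suc i) = refl
ωᶻ-below (suc J) i = ωᶻ-below J i

ωᶻ-diagonal : ∀ N → ωᶻ N N ≡ 0
ωᶻ-diagonal N = trans (cong (ωᶻ N) (sym (+-identityʳ N))) (ωᶻ-above N 0)

ωᶻ-step : ∀ N J → ωᶻ N (suc J) + 3 * N ≡ ωᶻ N J + 3 * J + 2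
ωᶻ-step zero J = identity (ω⁺ J) J
  where
  identity : ∀ w j → w + (3 * j + 2) + 3 * 0 ≡ w + 3 * j + 2
  identity = solve-∀
ωᶻ-step (suc N) zero rewrite ωᶻ-below 0 N = identity (ω⁻ N) N
  where
  identity : ∀ w n → w + 3 * (1 + n) ≡ w + (3 * n + 1) + 3 * 0 + 2
  identity = solve-∀
ωᶻ-step (suc N) (suc J) = begin
  ωᶻ N (suc J) + 3 * suc N     ≡⟨ shift3 (ωᶻ N (suc J)) N ⟩
  ωᶻ N (suc J) + 3 * N + 3     ≡⟨ cong (_+ 3) (ωᶻ-step N J) ⟩
  ωᶻ N J + 3 * J + 2 + 3       ≡⟨ shift3′ (ωᶻ N J) J ⟩
  ωᶻ N J + 3 * suc J + 2       ∎
  where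
  open ≡-Reasoning
  shift3 : ∀ w n → w + 3 * (1 + n) ≡ w + 3 * n + 3
  shift3 = solve-∀
  shift3′ : ∀ w j → w + 3 * j + 2 + 3 ≡ w + 3 * (1 + j) + 2
  shift3′ = solve-∀

ω⁺-mono : ∀ {i j} → i ≤ j → ω⁺ i ≤ ω⁺ j
ω⁺-mono = monotone-by-step ω⁺ (λ n → m≤m+n (ω⁺ n) _)

ω⁻-mono : ∀ {i j} → i ≤ j → ω⁻ i ≤ ω⁻ j
ω⁻-mono = monotone-by-step ω⁻ (λ n → m≤m+n (ω⁻ n) _)

n≤ω⁺n : ∀ k → k ≤ ω⁺ k
n≤ω⁺n zero = z≤n
n≤ω⁺n (suc k) = subst (_≤ ω⁺ k + (3 * k + 2)) (+-comm k 1)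
  (+-mono-≤ (n≤ω⁺n k) (≤-trans (s≤s z≤n) (m≤n+m 2 (3 * k))))

ω⁻+n≡ω⁺ : ∀ k → ω⁻ k + k ≡ ω⁺ k
ω⁻+n≡ω⁺ zero = refl
ω⁻+n≡ω⁺ (suc k) = begin
  ω⁻ k + (3 * k + 1) + suc k ≡⟨ regroup (ω⁻ k) k ⟩
  ω⁻ k + k + (3 * k + 2)     ≡⟨ cong (_+ (3 * k + 2)) (ω⁻+n≡ω⁺ k) ⟩
  ω⁺ k + (3 * k + 2)         ∎
  where
  open ≡-Reasoning
  regroup : ∀ w k → w + (3 * k + 1) + (1 + k) ≡ w + k + (3 * k + 2)
  regroup = solve-∀

ω⁺[i]+k≤ω⁺[k] : ∀ {i k} → i < k → ω⁺ i + k ≤ ω⁺ k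
ω⁺[i]+k≤ω⁺[k] {k = suc k} (s≤s i≤k) =
  +-mono-≤ (ω⁺-mono i≤k) (subst (_≤ 3 * k + 2) (+-comm k 1) (+-mono-≤ (m≤n*m k 3) (s≤s z≤n)))

ω⁺[k]<ω⁻[1+k] : ∀ k → ω⁺ k < ω⁻ (suc k)
ω⁺[k]<ω⁻[1+k] k = subst (_< ω⁻ k + (3 * k + 1)) (ω⁻+n≡ω⁺ k)
  (+-monoʳ-< (ω⁻ k) (subst (k <_) (+-comm 1 (3 * k)) (s≤s (m≤n*m k 3))))

∸≤ωᶻ : ∀ N J → J ∸ N ≤ ωᶻ N J
∸≤ωᶻ zero J = n≤ω⁺n J
∸≤ωᶻ (suc N) zero = z≤n
∸≤ωᶻ (suc N) (suc J) = ∸≤ωᶻ N J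

ω⁺-gap : ∀ k N J → J ≢ N + k → ωᶻ N J + k ≤ ω⁺ k ⊎ ω⁺ k < ωᶻ N J
ω⁺-gap k N J J≢N+k with N ≤? J
... | yes N≤J with m≤n⇒∃[o]m+o≡n N≤J
...   | i , refl rewrite ωᶻ-above N i with <-cmp i k
...     | tri≈ _ refl _ = ⊥-elim (J≢N+k refl)
...     | tri< i<k _ _ = inj₁ (ω⁺[i]+k≤ω⁺[k] i<k)
...     | tri> _ _ k<i =
  inj₂ (<-≤-trans (m<m+n (ω⁺ k) (≤-trans (s≤s z≤n) (m≤n+m 2 (3 * k)))) (ω⁺-mono k<i))
ω⁺-gap k N J J≢N+k | no N≰J with m≤n⇒∃[o]m+o≡n (<⇒≤ (≰⇒> N≰J))
... | i , refl rewrite ωᶻ-below J i with i ≤? k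
...   | yes i≤k = inj₁ (subst (ω⁻ i + k ≤_) (ω⁻+n≡ω⁺ k) (+-monoˡ-≤ k (ω⁻-mono i≤k)))
...   | no i≰k = inj₂ (<-≤-trans (ω⁺[k]<ω⁻[1+k] k) (ω⁻-mono (≰⇒> i≰k)))

largest : List ℕ → ℕ
largest [] = 0
largest (x ∷ _) = x

Partition : List ℕ → Set
Partition π = Partition≤ (largest π) π

Partition≤⇒Partition : ∀ {b π} → Partition≤ b π → Partition π
Partition≤⇒Partition [] = []
Partition≤⇒Partition (cons 1≤x _ π) = cons 1≤x ≤-refl π

Partition⇒Partition≤sum : ∀ {π} → Partition π → Partition≤ (sumℕ π) π
Partition⇒Partition≤sum [] = []
Partition⇒Partition≤sum (cons 1≤x _ π) = cons 1≤x (m≤m+n _ _) π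

length≤sumℕ : ∀ {b π} → Partition≤ b π → length π ≤ sumℕ π
length≤sumℕ [] = z≤n
length≤sumℕ (cons 1≤x _ π) = +-mono-≤ 1≤x (length≤sumℕ π)

ones : ℕ → List ℕ
ones c = replicate c 1

Partition≤1⇒ones : ∀ {π} → Partition≤ 1 π → π ≡ ones (length π)
Partition≤1⇒ones [] = refl
Partition≤1⇒ones (cons (s≤s z≤n) (s≤s z≤n) π) = cong (1 ∷_) (Partition≤1⇒ones π)

sumℕ-ones : ∀ c → sumℕ (ones c) ≡ c
sumℕ-ones zero = refl
sumℕ-ones (suc c) = cong suc (sumℕ-ones c)

Partition≤-ones : ∀ c → Partition≤ 1 (ones c)
Partition≤-ones zero = []
Partition≤-ones (suc c) = cons ≤-refl ≤-refl (Partition≤-ones c)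

-- decrementParts stops at the first part ≤ 1; on a partition it thus subtracts 1
-- from every part and drops the trailing 1s, which incrementParts ρ c restores.
decrementParts : List ℕ → List ℕ
decrementParts [] = []
decrementParts (suc (suc x) ∷ xs) = suc x ∷ decrementParts xs
decrementParts (_ ∷ _) = []

incrementParts : List ℕ → ℕ → List ℕ
incrementParts ρ c = map suc ρ ++ ones c

decrementParts-ones : ∀ {π} → Partition≤ 1 π → decrementParts π ≡ []
decrementParts-ones [] = refl
decrementParts-ones (cons (s≤s z≤n) (s≤s z≤n) _) = refl

Partition-decrementParts : ∀ {b π} → Partition≤ (suc b) π → Partition≤ b (decrementParts π)
Partition-decrementParts [] = []
Partition-decrementParts (cons {x = suc zero} _ _ _) = []
Partition-decrementParts (cons {x = suc (suc x)} _ (s≤s x<b) π) = cons (s≤s z≤n) x<b (Partition-decrementParts π)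

length-decrementParts : ∀ π → length (decrementParts π) ≤ length π
length-decrementParts [] = z≤n
length-decrementParts (zero ∷ _) = z≤n
length-decrementParts (suc zero ∷ _) = z≤n
length-decrementParts (suc (suc x) ∷ π) = s≤s (length-decrementParts π)

sumℕ-decrementParts : ∀ {b π} → Partition≤ b π → sumℕ (decrementParts π) + length π ≡ sumℕ π
sumℕ-decrementParts [] = refl
sumℕ-decrementParts (cons {x = suc zero} _ _ π) =
  cong suc (sym (trans (cong sumℕ (Partition≤1⇒ones π)) (sumℕ-ones _)))
sumℕ-decrementParts (cons {x = suc (suc x)} {xs = π} _ _ π≤) = begin
  suc (x + sumℕ (decrementParts π) + suc (length π)) ≡⟨ cong suc (+-suc _ (length π)) ⟩
  suc (suc (x + sumℕ (decrementParts π) + length π)) ≡⟨ cong (suc ∘ suc) (+-assoc x _ _) ⟩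
  suc (suc (x + (sumℕ (decrementParts π) + length π)))
    ≡⟨ cong (λ s → suc (suc (x + s))) (sumℕ-decrementParts π≤) ⟩
  suc (suc (x + sumℕ π)) ∎
  where open ≡-Reasoning

incrementParts-decrementParts : ∀ {b π} → Partition≤ b π →
  incrementParts (decrementParts π) (length π ∸ length (decrementParts π)) ≡ π
incrementParts-decrementParts [] = refl
incrementParts-decrementParts (cons {x = suc zero} _ _ π) = cong (1 ∷_) (sym (Partition≤1⇒ones π))
incrementParts-decrementParts (cons {x = suc (suc x)} _ _ π) = cong (suc (suc x) ∷_) (incrementParts-decrementParts π)

decrementParts-incrementParts : ∀ {b ρ} → Partition≤ b ρ → ∀ c → decrementParts (incrementParts ρ c) ≡ ρ
decrementParts-incrementParts [] zero = refl
decrementParts-incrementParts [] (suc c) = refl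
decrementParts-incrementParts (cons {x = suc x} _ _ ρ) c = cong (suc x ∷_) (decrementParts-incrementParts ρ c)

Partition-incrementParts : ∀ {b ρ} → Partition≤ b ρ → ∀ c → Partition≤ (suc b) (incrementParts ρ c)
Partition-incrementParts [] c = Partition≤-weaken (s≤s z≤n) (Partition≤-ones c)
Partition-incrementParts (cons _ x≤b ρ) c = cons (s≤s z≤n) (s≤s x≤b) (Partition-incrementParts ρ c)

largest-incrementParts : ∀ {b ρ} → Partition≤ b ρ → ∀ c → largest (incrementParts ρ c) ≤ suc b
largest-incrementParts [] zero = z≤n
largest-incrementParts [] (suc c) = s≤s z≤n
largest-incrementParts (cons _ x≤b _) c = s≤s x≤b

length-incrementParts : ∀ ρ c → length (incrementParts ρ c) ≡ length ρ + c
length-incrementParts ρ c = trans (length-++ (map suc ρ)) (cong₂ _+_ (length-map suc ρ) (length-replicate c))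

sumℕ-incrementParts : ∀ ρ c → sumℕ (incrementParts ρ c) ≡ sumℕ ρ + length ρ + c
sumℕ-incrementParts [] c = sumℕ-ones c
sumℕ-incrementParts (x ∷ ρ) c rewrite sumℕ-incrementParts ρ c = regroup x (sumℕ ρ) (length ρ) c
  where
  regroup : ∀ x s l c → 1 + (x + (s + l + c)) ≡ x + s + (1 + l) + c
  regroup = solve-∀

consPositive : ℕ → List ℕ → List ℕ
consPositive zero ρ = ρ
consPositive (suc a) ρ = suc a ∷ ρ

sumℕ-consPositive : ∀ a ρ → sumℕ (consPositive a ρ) ≡ a + sumℕ ρ
sumℕ-consPositive zero ρ = refl
sumℕ-consPositive (suc a) ρ = refl

Partition-consPositive-decrementParts : ∀ a {π} → Partition≤ (suc a) π →
                                        Partition (consPositive a (decrementParts π))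
Partition-consPositive-decrementParts zero π = Partition≤⇒Partition (Partition-decrementParts π)
Partition-consPositive-decrementParts (suc a) π = cons (s≤s z≤n) ≤-refl (Partition-decrementParts π)

Partition-drop : ∀ {π} → Partition π → Partition≤ (largest π) (drop 1 π)
Partition-drop [] = []
Partition-drop (cons _ _ ρ) = ρ

sumℕ-largest-drop : ∀ π → sumℕ π ≡ largest π + sumℕ (drop 1 π)
sumℕ-largest-drop [] = refl
sumℕ-largest-drop (_ ∷ _) = refl

consPositive-largest-drop : ∀ {π} → Partition π → consPositive (largest π) (drop 1 π) ≡ π
consPositive-largest-drop [] = refl
consPositive-largest-drop (cons (s≤s z≤n) _ _) = refl

-- A state (J , π) stands for the pair (J - N , π) of an integer and a partition.
weight : ℕ → ℕ × List ℕ → ℕ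
weight N (J , π) = sumℕ π + ωᶻ N J

stepDown : ℕ → ℕ → List ℕ → List ℕ
stepDown N J π = consPositive (length π + 3 * J ∸ (3 * N + 1)) (decrementParts π)

stepUp : ℕ → ℕ → List ℕ → List ℕ
stepUp N J π = incrementParts (drop 1 π) (largest π + 3 * N ∸ (length (drop 1 π) + 3 * J + 2))

-- The Bressoud–Zeilberger involution: with j = J - N, ℓ = length π and h = largest π,
-- if h ≤ ℓ + 3j subtract 1 from every part and insert a part ℓ + 3j - 1 (j ↦ j - 1);
-- otherwise remove h, add 1 to the other parts and append h - ℓ - 3j - 1 ones (j ↦ j + 1).
bz : ℕ → ℕ × List ℕ → ℕ × List ℕ
bz N (J , π) with largest π + 3 * N ≤? length π + 3 * J
... | yes _ = J ∸ 1 , stepDown N J π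
... | no _ = suc J , stepUp N J π

bz-down : ∀ N J π → largest π + 3 * N ≤ length π + 3 * J → bz N (J , π) ≡ (J ∸ 1 , stepDown N J π)
bz-down N J π down with largest π + 3 * N ≤? length π + 3 * J
... | yes _ = refl
... | no up = ⊥-elim (up down)

bz-up : ∀ N J π → length π + 3 * J < largest π + 3 * N → bz N (J , π) ≡ (suc J , stepUp N J π)
bz-up N J π up with largest π + 3 * N ≤? length π + 3 * J
... | yes down = ⊥-elim (<⇒≱ up down)
... | no _ = refl

module StepDown (N J : ℕ) {π} (π-partition : Partition π) (a : ℕ)
                (a-def : a + (3 * N + 1) ≡ length π + 3 * suc J)
                (down : largest π + 3 * N ≤ length π + 3 * suc J) where

  π′ : List ℕ
  π′ = consPositive a (decrementParts π)

  largest≤1+a : largest π ≤ suc a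
  largest≤1+a = +-cancelʳ-≤ (3 * N) (largest π) (suc a)
    (≤-trans down (≤-reflexive (trans (sym a-def) (shift a N))))
    where
    shift : ∀ a n → a + (3 * n + 1) ≡ suc a + 3 * n
    shift = solve-∀

  partition : Partition π′
  partition = Partition-consPositive-decrementParts a (Partition≤-weaken largest≤1+a π-partition)

  weight-preserved : weight N (J , π′) ≡ weight N (suc J , π)
  weight-preserved rewrite sumℕ-consPositive a (decrementParts π) =
    cancel-≡ (cong₂ _+_ (cong₂ _+_ a-def (sumℕ-decrementParts π-partition)) (sym (ωᶻ-step N J)))
      (identity a (sumℕ (decrementParts π)) (ωᶻ N J) (sumℕ π) (ωᶻ N (suc J)) (length π) N J)
    where
    identity : ∀ a sd w s w′ ℓ n j →
      a + sd + w + ((ℓ + 3 * (1 + j)) + s + (w′ + 3 * n))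
        ≡ s + w′ + ((a + (3 * n + 1)) + (sd + ℓ) + (w + 3 * j + 2))
    identity = solve-∀

  inverse-without-new-part : 0 + (3 * N + 1) ≡ length π + 3 * suc J → largest π ≤ 1 →
                             bz N (J , decrementParts π) ≡ (suc J , π)
  inverse-without-new-part a≡0 largest≤1 rewrite decrementParts-ones (Partition≤-weaken largest≤1 π-partition) =
    trans (bz-up N J [] (subst (3 * J <_) (sym 3N≡) (m<m+n (3 * J) (s≤s z≤n))))
          (cong (suc J ,_) (trans (cong ones count) (sym (Partition≤1⇒ones π≤1))))
    where
    π≤1 = Partition≤-weaken largest≤1 π-partition
    3N≡ : 3 * N ≡ 3 * J + (2 + length π)
    3N≡ = cancel-≡ a≡0 (identity N J (length π))
      where
      identity : ∀ n j ℓ → 3 * n + (ℓ + 3 * (1 + j)) ≡ 3 * j + (2 + ℓ) + (0 + (3 * n + 1))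
      identity = solve-∀
    count : 3 * N ∸ (3 * J + 2) ≡ length π
    count = m≡n+o⇒m∸o≡n _ _ (trans 3N≡ (identity J (length π)))
      where
      identity : ∀ j ℓ → 3 * j + (2 + ℓ) ≡ ℓ + (3 * j + 2)
      identity = solve-∀

  inverse-with-new-part : ∀ a → suc a + (3 * N + 1) ≡ length π + 3 * suc J →
                          bz N (J , suc a ∷ decrementParts π) ≡ (suc J , π)
  inverse-with-new-part a a-def with m≤n⇒∃[o]m+o≡n (length-decrementParts π)
  ... | d , ℓ′+d≡ℓ =
    trans (bz-up N J (suc a ∷ decrementParts π) up)
          (cong (suc J ,_) (trans (cong (incrementParts (decrementParts π)) count)
                                  (incrementParts-decrementParts π-partition)))
    where
    ℓ′ = length (decrementParts π)
    total : suc a + 3 * N ≡ d + (ℓ′ + 3 * J + 2)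
    total = cancel-≡ (cong₂ _+_ a-def (sym ℓ′+d≡ℓ)) (identity a N ℓ′ J d (length π))
      where
      identity : ∀ a n ℓ′ j d ℓ →
        suc a + 3 * n + (ℓ + 3 * (1 + j) + (ℓ′ + d))
          ≡ d + (ℓ′ + 3 * j + 2) + (suc a + (3 * n + 1) + ℓ)
      identity = solve-∀
    up : suc ℓ′ + 3 * J < suc a + 3 * N
    up = subst₂ _≤_ (shift ℓ′ J) (sym total) (m≤n+m (ℓ′ + 3 * J + 2) d)
      where
      shift : ∀ ℓ j → ℓ + 3 * j + 2 ≡ 2 + (ℓ + 3 * j)
      shift = solve-∀
    count : suc a + 3 * N ∸ (ℓ′ + 3 * J + 2) ≡ length π ∸ ℓ′
    count = trans (m≡n+o⇒m∸o≡n d _ total)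
                  (sym (m≡n+o⇒m∸o≡n d ℓ′ (trans (sym ℓ′+d≡ℓ) (+-comm ℓ′ d))))

  inverse : bz N (J , π′) ≡ (suc J , π)
  inverse = invert a a-def largest≤1+a
    where
    invert : ∀ a → a + (3 * N + 1) ≡ length π + 3 * suc J → largest π ≤ suc a →
             bz N (J , consPositive a (decrementParts π)) ≡ (suc J , π)
    invert zero a≡0 largest≤1 = inverse-without-new-part a≡0 largest≤1
    invert (suc a) a-def _ = inverse-with-new-part a a-def

stepUp-slack : ∀ N J π → length π + 3 * J < largest π + 3 * N →
               length (drop 1 π) + 3 * J + 2 ≤ largest π + 3 * N
stepUp-slack N J [] up =
  ≤-trans (≤-trans (m≤m+n (3 * J + 2) 1) (≤-reflexive (identity J))) (*-monoʳ-≤ 3 (*-cancelˡ-< 3 J N up))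
  where
  identity : ∀ j → 3 * j + 2 + 1 ≡ 3 * (1 + j)
  identity = solve-∀
stepUp-slack N J (h ∷ ρ) up = subst (_≤ h + 3 * N) (+-comm 2 (length ρ + 3 * J)) up

module StepUp (N J : ℕ) {π} (π-partition : Partition π)
              (up : length π + 3 * J < largest π + 3 * N) where

  h = largest π
  ρ = drop 1 π
  c = h + 3 * N ∸ (length ρ + 3 * J + 2)

  c-def : c + (length ρ + 3 * J + 2) ≡ h + 3 * N
  c-def = m∸n+n≡m (stepUp-slack N J π up)

  π′ : List ℕ
  π′ = stepUp N J π

  partition : Partition π′
  partition = Partition≤⇒Partition (Partition-incrementParts (Partition-drop π-partition) c)

  weight-preserved : weight N (suc J , π′) ≡ weight N (J , π)
  weight-preserved rewrite sumℕ-incrementParts ρ c | sumℕ-largest-drop π =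
    cancel-≡ (cong₂ _+_ c-def (ωᶻ-step N J))
      (identity (sumℕ ρ) (length ρ) c (ωᶻ N (suc J)) h N (ωᶻ N J) J)
    where
    identity : ∀ s ℓ c w′ h n w j →
      s + ℓ + c + w′ + (h + 3 * n + (w + 3 * j + 2))
        ≡ h + s + w + (c + (ℓ + 3 * j + 2) + (w′ + 3 * n))
    identity = solve-∀

  inverse : bz N (suc J , π′) ≡ (J , π)
  inverse = trans (bz-down N (suc J) π′ down) (cong (J ,_) (begin
    consPositive (length π′ + 3 * suc J ∸ (3 * N + 1)) (decrementParts π′)
      ≡⟨ cong₂ consPositive (m≡n+o⇒m∸o≡n h (3 * N + 1) total)
                            (decrementParts-incrementParts (Partition-drop π-partition) c) ⟩
    consPositive h ρ
      ≡⟨ consPositive-largest-drop π-partition ⟩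
    π ∎))
    where
    open ≡-Reasoning
    total : length π′ + 3 * suc J ≡ h + (3 * N + 1)
    total rewrite length-incrementParts ρ c = cancel-≡ c-def (identity (length ρ) c J h N)
      where
      identity : ∀ ℓ c j h n → ℓ + c + 3 * (1 + j) + (h + 3 * n) ≡ h + (3 * n + 1) + (c + (ℓ + 3 * j + 2))
      identity = solve-∀
    down : largest π′ + 3 * N ≤ length π′ + 3 * suc J
    down = ≤-trans (+-monoˡ-≤ (3 * N) (largest-incrementParts (Partition-drop π-partition) c))
                   (≤-reflexive (trans (identity h N) (sym total)))
      where
      identity : ∀ h n → suc h + 3 * n ≡ h + (3 * n + 1)
      identity = solve-∀

block : ℕ → ℕ → ℕ → List (ℕ × List ℕ)
block N n J with ωᶻ N J ≤? n
... | yes _ = map (J ,_) (partitions (n ∸ ωᶻ N J))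
... | no _ = []

length-block-≤ : ∀ N n J → ωᶻ N J ≤ n → length (block N n J) ≡ p (n ∸ ωᶻ N J)
length-block-≤ N n J ω≤n with ωᶻ N J ≤? n
... | yes _ = length-map (J ,_) (partitions (n ∸ ωᶻ N J))
... | no ω≰n = ⊥-elim (ω≰n ω≤n)

length-block-> : ∀ N n J → n < ωᶻ N J → length (block N n J) ≡ 0
length-block-> N n J n<ω with ωᶻ N J ≤? n
... | yes ω≤n = ⊥-elim (<⇒≱ n<ω ω≤n)
... | no _ = refl

∈-block⁻ : ∀ N n J {s} → s ∈ block N n J →
           ωᶻ N J ≤ n × ∃[ π ] s ≡ (J , π) × π ∈ partitions (n ∸ ωᶻ N J)
∈-block⁻ N n J s∈ with ωᶻ N J ≤? n
... | yes ω≤n = let π , π∈ , s≡ = ∈-map⁻ _ s∈ in ω≤n , π , s≡ , π∈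

∈-block⁺ : ∀ N n J {π} → ωᶻ N J ≤ n → π ∈ partitions (n ∸ ωᶻ N J) → (J , π) ∈ block N n J
∈-block⁺ N n J ω≤n π∈ with ωᶻ N J ≤? n
... | yes _ = ∈-map⁺ _ π∈
... | no ω≰n = ⊥-elim (ω≰n ω≤n)

-- For n < N every state of weight n has J ≤ 2N, so these are all of them.
states : ℕ → ℕ → List (ℕ × List ℕ)
states N n = concatMap (block N n) (upTo (suc (2 * N)))

∈-states⁻ : ∀ N n {J π} → (J , π) ∈ states N n → Partition π × weight N (J , π) ≡ n
∈-states⁻ N n s∈ with ∈-concatMap⁻′ (block N n) (upTo (suc (2 * N))) s∈
... | J , _ , s∈block with ∈-block⁻ N n J s∈block
... | ω≤n , π , refl , π∈ with ∈-partitions⁻ π∈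
... | π≤ , sumπ = Partition≤⇒Partition π≤ , trans (cong (_+ ωᶻ N J) sumπ) (m∸n+n≡m ω≤n)

∈-states⁺ : ∀ N n {J π} → n < N → Partition π → weight N (J , π) ≡ n → (J , π) ∈ states N n
∈-states⁺ N n {J} {π} n<N π-partition weight≡n =
  ∈-concatMap⁺′ (block N n) (∈-upTo⁺ (s≤s J≤2N)) (∈-block⁺ N n J ω≤n (∈-partitions⁺ π≤ sumπ))
  where
  ω≤n : ωᶻ N J ≤ n
  ω≤n = subst (ωᶻ N J ≤_) weight≡n (m≤n+m (ωᶻ N J) (sumℕ π))
  sumπ : sumℕ π ≡ n ∸ ωᶻ N J
  sumπ = sym (m≡n+o⇒m∸o≡n (sumℕ π) (ωᶻ N J) (sym weight≡n))
  π≤ : Partition≤ (n ∸ ωᶻ N J) π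
  π≤ = subst (λ b → Partition≤ b π) sumπ (Partition⇒Partition≤sum π-partition)
  J≤2N : J ≤ 2 * N
  J≤2N with J ≤? 2 * N
  ... | yes J≤2N = J≤2N
  ... | no J≰2N = ⊥-elim (<⇒≱ n<N (≤-trans N≤J∸N (≤-trans (∸≤ωᶻ N J) ω≤n)))
    where
    N≤J∸N : N ≤ J ∸ N
    N≤J∸N = subst (_≤ J ∸ N) (m+n∸n≡m N N)
      (∸-monoˡ-≤ N (subst (_≤ J) (cong (N +_) (+-identityʳ N)) (<⇒≤ (≰⇒> J≰2N))))

states-unique : ∀ N n → Unique (states N n)
states-unique N n = concatMap-unique (block N n) proj₁ key block-unique (upTo⁺ (suc (2 * N)))
  where
  key : ∀ {J s} → s ∈ block N n J → proj₁ s ≡ J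
  key {J} s∈ with ∈-block⁻ N n J s∈
  ... | _ , _ , refl , _ = refl
  block-unique : ∀ J → Unique (block N n J)
  block-unique J with ωᶻ N J ≤? n
  ... | yes _ = Unique.map⁺ (cong proj₂) (partsLE-unique (n ∸ ωᶻ N J) (n ∸ ωᶻ N J))
  ... | no _ = []

module BzOnStates (N n : ℕ) (1≤n : 1 ≤ n) (n<N : n < N) where

  down⇒1≤J : ∀ {J π} → Partition π → weight N (J , π) ≡ n →
             largest π + 3 * N ≤ length π + 3 * J → 1 ≤ J
  down⇒1≤J {suc J} _ _ _ = s≤s z≤n
  down⇒1≤J {zero} {π} π-partition weight≡n down = ⊥-elim (<⇒≱ n<N (begin
    N                        ≤⟨ m≤m+n N (2 * N) ⟩
    3 * N                    ≤⟨ m≤n+m (3 * N) (largest π) ⟩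
    largest π + 3 * N        ≤⟨ down ⟩
    length π + 0             ≡⟨ +-identityʳ (length π) ⟩
    length π                 ≤⟨ length≤sumℕ π-partition ⟩
    sumℕ π                   ≤⟨ m≤m+n (sumℕ π) (ωᶻ N 0) ⟩
    weight N (0 , π)         ≡⟨ weight≡n ⟩
    n                        ∎))
    where open ≤-Reasoning

  down⇒newPart : ∀ {J π} → Partition π → weight N (J , π) ≡ n →
                 largest π + 3 * N ≤ length π + 3 * J → 3 * N + 1 ≤ length π + 3 * J
  down⇒newPart {J} (cons 1≤h _ _) _ down =
    ≤-trans (≤-reflexive (+-comm (3 * N) 1)) (≤-trans (+-monoˡ-≤ (3 * N) 1≤h) down)
  down⇒newPart {J} [] weight≡n down with N ≟ J
  ... | yes refl = ⊥-elim (<⇒≱ 1≤n (≤-reflexive (trans (sym weight≡n) (ωᶻ-diagonal N))))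
  ... | no N≢J = ≤-trans (≤-trans (m≤m+n (3 * N + 1) 2) (≤-reflexive (identity N)))
                        (*-monoʳ-≤ 3 (≤∧≢⇒< (*-cancelˡ-≤ 3 down) N≢J))
    where
    identity : ∀ n → 3 * n + 1 + 2 ≡ 3 * (1 + n)
    identity = solve-∀

  down-properties : ∀ {J π} → Partition π → weight N (J , π) ≡ n →
                    largest π + 3 * N ≤ length π + 3 * J →
                    (J ∸ 1 , stepDown N J π) ∈ states N n ×
                    bz N (J ∸ 1 , stepDown N J π) ≡ (J , π) × (J ∸ 1 , stepDown N J π) ≢ (J , π)
  down-properties {zero} π-partition weight≡n down =
    ⊥-elim (<⇒≱ (down⇒1≤J π-partition weight≡n down) ≤-refl)
  down-properties {suc J} {π} π-partition weight≡n down =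
    ∈-states⁺ N n n<N partition (trans weight-preserved weight≡n) , inverse , 1+n≢n ∘ sym ∘ cong proj₁
    where
    open StepDown N J π-partition (length π + 3 * suc J ∸ (3 * N + 1))
                  (m∸n+n≡m (down⇒newPart π-partition weight≡n down)) down

  up-properties : ∀ {J π} → Partition π → weight N (J , π) ≡ n →
                  length π + 3 * J < largest π + 3 * N →
                  (suc J , stepUp N J π) ∈ states N n ×
                  bz N (suc J , stepUp N J π) ≡ (J , π) × (suc J , stepUp N J π) ≢ (J , π)
  up-properties {J} π-partition weight≡n up =
    ∈-states⁺ N n n<N partition (trans weight-preserved weight≡n) , inverse , 1+n≢n ∘ cong proj₁
    where open StepUp N J π-partition up

  bz-properties : ∀ {s} → s ∈ states N n → bz N s ∈ states N n × bz N (bz N s) ≡ s × bz N s ≢ s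
  bz-properties {J , π} s∈ with ∈-states⁻ N n s∈ | largest π + 3 * N ≤? length π + 3 * J
  ... | π-partition , weight≡n | yes down = down-properties π-partition weight≡n down
  ... | π-partition , weight≡n | no ¬down = up-properties π-partition weight≡n (≰⇒> ¬down)

  bz-involution : FixedPointFreeInvolutionOn (bz N) (states N n)
  bz-involution = record
    { closed = proj₁ ∘ bz-properties
    ; involutive = proj₁ ∘ proj₂ ∘ bz-properties
    ; fixedPointFree = proj₂ ∘ proj₂ ∘ bz-properties
    }

  states-even : parity (length (states N n)) ≡ 0ℙ
  states-even =
    FixedPointFreeInvolution⇒even-length (×-≡-dec _≟_ (List-≡-dec _≟_)) (states-unique N n) bz-involution

-- With 1 + m = ω⁺ (1 + k), compare the even sums for weights 1 + m and m index by index: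
-- the index J - N = 1 + k contributes p 0 + 0, every other one nothing or p (1 + a) + p a
-- with both arguments in the window (ω⁺-gap).
module AllOddWindow (k : ℕ) (all-odd : ∀ {i} → k ≤ i → i ≤ ω⁺ (suc k) → parity (p i) ≡ 1ℙ) where

  m : ℕ
  m = ω⁺ k + (3 * k + 1)

  ω⁺[1+k]≡1+m : ω⁺ (suc k) ≡ suc m
  ω⁺[1+k]≡1+m = identity (ω⁺ k) k
    where
    identity : ∀ w k → w + (3 * k + 2) ≡ 1 + (w + (3 * k + 1))
    identity = solve-∀

  ≤1+m⇒≤ω⁺ : ∀ {i} → i ≤ suc m → i ≤ ω⁺ (suc k)
  ≤1+m⇒≤ω⁺ i≤ = ≤-trans i≤ (≤-reflexive (sym ω⁺[1+k]≡1+m))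

  N : ℕ
  N = suc (suc m)

  indices : List ℕ
  indices = upTo (suc (2 * N))

  count : ℕ → ℕ → ℕ
  count n J = length (block N n J)

  count-≡ : ∀ {n} a J → n ≡ a + ωᶻ N J → count n J ≡ p a
  count-≡ a J refl = trans (length-block-≤ N _ J (m≤n+m _ a)) (cong p (m+n∸n≡m a (ωᶻ N J)))

  pairCount : ℕ → ℕ
  pairCount J = count (suc m) J + count m J

  1≤m : 1 ≤ m
  1≤m = ≤-trans (m≤n+m 1 (3 * k)) (m≤n+m _ (ω⁺ k))

  pairCount-sum-even : parity (sumℕ (map pairCount indices)) ≡ 0ℙ
  pairCount-sum-even = begin
    parity (sumℕ (map pairCount indices))
      ≡⟨ cong parity (sumℕ-map-+ (count (suc m)) (count m) indices) ⟩
    parity (sumℕ (map (count (suc m)) indices) + sumℕ (map (count m) indices))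
      ≡⟨ cong parity (cong₂ _+_ (length-concatMap (block N (suc m)) indices)
                                (length-concatMap (block N m) indices)) ⟨
    parity (length (states N (suc m)) + length (states N m))
      ≡⟨ +-homo-+ (length (states N (suc m))) _ ⟩
    parity (length (states N (suc m))) ℙ.+ parity (length (states N m))
      ≡⟨ cong₂ ℙ._+_ (BzOnStates.states-even N (suc m) (s≤s z≤n) ≤-refl)
                     (BzOnStates.states-even N m 1≤m (n≤1+n _)) ⟩
    0ℙ ∎
    where open ≡-Reasoning

  centre : ℕ
  centre = N + suc k

  ω-centre : ωᶻ N centre ≡ suc m
  ω-centre = trans (ωᶻ-above N (suc k)) ω⁺[1+k]≡1+m

  centre∈indices : centre ∈ indices
  centre∈indices = ∈-upTo⁺ (s≤s (+-monoʳ-≤ N (≤-trans (n≤ω⁺n (suc k))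
    (≤-trans (≤-reflexive ω⁺[1+k]≡1+m) (≤-trans (n≤1+n _) (m≤m+n N 0))))))

  pairCount-centre : parity (pairCount centre) ≡ 1ℙ
  pairCount-centre
    rewrite count-≡ 0 centre (sym ω-centre)
          | length-block-> N m centre (subst (m <_) (sym ω-centre) ≤-refl) = refl

  pairCount-window : ∀ J a → k ≤ a → suc m ≡ suc a + ωᶻ N J → parity (pairCount J) ≡ 0ℙ
  pairCount-window J a k≤a 1+m≡
    rewrite count-≡ (suc a) J 1+m≡ | count-≡ a J (suc-injective 1+m≡)
          | +-homo-+ (p (suc a)) (p a)
          | all-odd (≤-trans k≤a (n≤1+n a)) (≤1+m⇒≤ω⁺ (≤-trans (m≤m+n _ _) (≤-reflexive (sym 1+m≡))))
          | all-odd k≤a (≤1+m⇒≤ω⁺ (≤-trans (n≤1+n a) (≤-trans (m≤m+n _ _) (≤-reflexive (sym 1+m≡))))) = refl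

  pairCount-elsewhere : ∀ {J} → J ∈ indices → J ≢ centre → parity (pairCount J) ≡ 0ℙ
  pairCount-elsewhere {J} _ J≢centre with ω⁺-gap (suc k) N J J≢centre
  ... | inj₂ ω⁺<ω
    rewrite length-block-> N (suc m) J (subst (_< ωᶻ N J) ω⁺[1+k]≡1+m ω⁺<ω)
          | length-block-> N m J (<-trans (n<1+n m) (subst (_< ωᶻ N J) ω⁺[1+k]≡1+m ω⁺<ω)) = refl
  ... | inj₁ ω+1+k≤ω⁺ with m≤n⇒∃[o]m+o≡n ω+1+k≤ω⁺
  ...   | d , total = pairCount-window J (k + d) (m≤m+n k d)
    (trans (sym ω⁺[1+k]≡1+m) (trans (sym total) (identity (ωᶻ N J) k d)))
    where
    identity : ∀ w k d → w + suc k + d ≡ suc (k + d) + w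
    identity = solve-∀

  pairCount-sum-odd : parity (sumℕ (map pairCount indices)) ≡ 1ℙ
  pairCount-sum-odd = parity-sumℕ-single-odd pairCount (upTo⁺ _) centre∈indices pairCount-centre pairCount-elsewhere

window-not-all-odd : ∀ k → ¬ (∀ {i} → k ≤ i → i ≤ ω⁺ (suc k) → parity (p i) ≡ 1ℙ)
window-not-all-odd k all-odd = p≢p⁻¹ 0ℙ (trans (sym pairCount-sum-even) pairCount-sum-odd)
  where open AllOddWindow k all-odd

p-even-in-window : ∀ k → ∃[ i ] k ≤ i × i ≤ ω⁺ (suc k) × parity (p i) ≡ 0ℙ
p-even-in-window k = reshape (decidable-stable (anyUpTo? even? (suc (ω⁺ (suc k)))) not-all-odd)
  where
  even? : ∀ i → Dec (k ≤ i × parity (p i) ≡ 0ℙ)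
  even? i = (k ≤? i) ×-dec (parity (p i) ≟ᵖ 0ℙ)
  not-all-odd : ¬ ¬ (∃[ i ] i < suc (ω⁺ (suc k)) × (k ≤ i × parity (p i) ≡ 0ℙ))
  not-all-odd none = window-not-all-odd k λ {i} k≤i i≤ω⁺ →
    parity≢0ℙ⇒1ℙ (λ even → none (i , s≤s i≤ω⁺ , k≤i , even))
  reshape : ∃[ i ] i < suc (ω⁺ (suc k)) × (k ≤ i × parity (p i) ≡ 0ℙ) →
            ∃[ i ] k ≤ i × i ≤ ω⁺ (suc k) × parity (p i) ≡ 0ℙ
  reshape (i , i<1+ω⁺ , k≤i , even) = i , k≤i , ≤-pred i<1+ω⁺ , even

p-even⇒positive : ∀ {i} → parity (p i) ≡ 0ℙ → 0 < i
p-even⇒positive {suc i} _ = s≤s z≤n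

evenCount-< : ∀ {A i B} → parity (p i) ≡ 0ℙ → A < i → i ≤ B → evenCount A < evenCount B
evenCount-< {A} {suc j} {B} even (s≤s A≤j) 1+j≤B = begin-strict
  evenCount A          ≤⟨ evenCount-mono A≤j ⟩
  evenCount j          <⟨ n<1+n (evenCount j) ⟩
  suc (evenCount j)    ≡⟨ evenCount-suc-even j even ⟨
  evenCount (suc j)    ≤⟨ evenCount-mono 1+j≤B ⟩
  evenCount B          ∎
  where open ≤-Reasoning

scale : ℕ → ℕ
scale zero = 1
scale (suc t) = suc (suc (ω⁺ (scale t)))

evenCount-scale : ∀ t → suc t ≤ evenCount (ω⁺ (scale t))
evenCount-scale zero with p-even-in-window 0
... | i , _ , i≤ω⁺ , even = evenCount-< {0} even (p-even⇒positive even) i≤ω⁺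
evenCount-scale (suc t) with p-even-in-window (suc (ω⁺ (scale t)))
... | i , ω⁺<i , i≤ω⁺ , even = ≤-trans (s≤s (evenCount-scale t)) (evenCount-< even ω⁺<i i≤ω⁺)

2*ω⁺ : ∀ k → 2 * ω⁺ k ≡ k * (3 * k + 1)
2*ω⁺ zero = refl
2*ω⁺ (suc k) = begin
  2 * (ω⁺ k + (3 * k + 2))        ≡⟨ *-distribˡ-+ 2 (ω⁺ k) (3 * k + 2) ⟩
  2 * ω⁺ k + 2 * (3 * k + 2)      ≡⟨ cong (_+ 2 * (3 * k + 2)) (2*ω⁺ k) ⟩
  k * (3 * k + 1) + 2 * (3 * k + 2) ≡⟨ identity k ⟩
  suc k * (3 * suc k + 1)         ∎
  where
  open ≡-Reasoning
  identity : ∀ k → k * (3 * k + 1) + 2 * (3 * k + 2) ≡ (1 + k) * (3 * (1 + k) + 1)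
  identity = solve-∀

4*ω⁺+2≤[4k]² : ∀ k → 1 ≤ k → 4 * (ω⁺ k + 2) ≤ (4 * k) * (4 * k)
4*ω⁺+2≤[4k]² (suc j) _ = ≤-trans (m≤m+n _ (10 * j * j + 18 * j)) (≤-reflexive
  (cancel-≡ (cong (2 *_) (2*ω⁺ (suc j))) (identity (ω⁺ (suc j)) j)))
  where
  identity : ∀ w j → 4 * (w + 2) + (10 * j * j + 18 * j) + 2 * ((1 + j) * (3 * (1 + j) + 1))
                       ≡ (4 * (1 + j)) * (4 * (1 + j)) + 2 * (2 * w)
  identity = solve-∀

1≤scale : ∀ t → 1 ≤ scale t
1≤scale zero = ≤-refl
1≤scale (suc t) = s≤s z≤n

4*scale≤2^2^ : ∀ t → 4 * scale t ≤ 2 ^ (2 ^ suc t)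
4*scale≤2^2^ zero = ≤-refl
4*scale≤2^2^ (suc t) = begin
  4 * (2 + ω⁺ (scale t))          ≡⟨ cong (4 *_) (+-comm 2 (ω⁺ (scale t))) ⟩
  4 * (ω⁺ (scale t) + 2)          ≤⟨ 4*ω⁺+2≤[4k]² (scale t) (1≤scale t) ⟩
  (4 * scale t) * (4 * scale t)   ≤⟨ *-mono-≤ (4*scale≤2^2^ t) (4*scale≤2^2^ t) ⟩
  2 ^ a * 2 ^ a                   ≡⟨ ^-distribˡ-+-* 2 a a ⟨
  2 ^ (a + a)                     ≡⟨ cong (λ e → 2 ^ (a + e)) (+-identityʳ a) ⟨
  2 ^ (2 ^ suc (suc t))           ∎
  where
  open ≤-Reasoning
  a = 2 ^ suc t

X<ω⁺[scale[evenCount]] : ∀ X → X < ω⁺ (scale (evenCount X))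
X<ω⁺[scale[evenCount]] X =
  ≰⇒> λ ω⁺≤X → 1+n≰n (≤-trans (evenCount-scale (evenCount X)) (evenCount-mono ω⁺≤X))

2+n≤3*n : ∀ {n} → 1 ≤ n → 2 + n ≤ 3 * n
2+n≤3*n {n} 1≤n = subst (_≤ 3 * n) (+-comm n 2) (+-monoʳ-≤ n (+-mono-≤ 1≤n (≤-trans 1≤n (m≤m+n n 0))))

theorem1p4 : ∃[ k ] ∃[ X₀ ] ((X : ℕ) → X₀ ≤ X → X ≤ 2 ^ (2 ^ (k * evenCount X)))
theorem1p4 = 3 , 2 , λ X 2≤X →
  let c = evenCount X
      1≤c = ≤-trans (evenCount-scale 0) (evenCount-mono 2≤X)
  in begin
    X                    ≤⟨ <⇒≤ (X<ω⁺[scale[evenCount]] X) ⟩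
    ω⁺ (scale c)         ≤⟨ m≤n+m _ 2 ⟩
    scale (suc c)        ≤⟨ m≤n*m (scale (suc c)) 4 ⟩
    4 * scale (suc c)    ≤⟨ 4*scale≤2^2^ (suc c) ⟩
    2 ^ (2 ^ (2 + c))    ≤⟨ ^-monoʳ-≤ 2 (^-monoʳ-≤ 2 (2+n≤3*n 1≤c)) ⟩
    2 ^ (2 ^ (3 * c))    ∎
  where open ≤-Reasoning
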